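{- Let $B_1=\{231,312,1432\}$. A nonempty permutation belongs to $\operatorname{Av}(B_1)$ if and only if it is of the form $(\pi\ominus 1)\oplus\sigma$, where $\pi$ is a decreasing permutation (possibly empty) and $\sigma$ is a Fibonacci permutation (possibly empty).
   Context: For a set $S$ of permutations, $\operatorname{Av}(S)$ is the set of all permutations avoiding every pattern in $S$ (classical pattern avoidance). A Fibonacci permutation is a permutation in $\operatorname{Av}(231,312,321)$. For permutations $\pi$ of length $n$ and $\sigma$ of length $k$, $\pi\oplus\sigma$ is $\pi$ followed by $\sigma$ with every entry of $\sigma$ increased by $n$; $\pi\ominus\sigma$ is $\pi$ followed by $\sigma$ with every entry of $\pi$ increased by $k$. Here $1$ denotes the permutation of length one. -}

module Defs where

open import Data.Nat using (ℕ; suc; _+_; _<_; _>_)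
open import Data.List using (List; []; _∷_; _++_; map; length; lookup; upTo)
open import Data.List.Relation.Binary.Sublist.Propositional using (_⊆_)
open import Data.List.Relation.Binary.Permutation.Propositional using (_↭_)
open import Data.List.Relation.Unary.All using (All)
open import Data.List.Relation.Unary.Linked using (Linked)
open import Data.Fin using (Fin; cast)
open import Data.Product using (Σ; ∃; _×_)
open import Relation.Binary.PropositionalEquality using (_≡_)
open import Relation.Nullary using (¬_)
open import Function.Bundles using (_⇔_)

-- A permutation of length n in one-line notation: a list that is a
-- rearrangement of 1,2,...,n.
IsPerm : List ℕ → Set
IsPerm xs = xs ↭ map suc (upTo (length xs))

OrderIso : List ℕ → List ℕ → Set
OrderIso xs ys = Σ (length xs ≡ length ys) λ eq →
  ∀ (i j : Fin (length xs)) →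
    (lookup xs i < lookup xs j) ⇔ (lookup ys (cast eq i) < lookup ys (cast eq j))

Contains : List ℕ → List ℕ → Set
Contains π σ = ∃ λ τ → (τ ⊆ π) × OrderIso τ σ

Avoids : List ℕ → List (List ℕ) → Set
Avoids π S = All (λ σ → ¬ Contains π σ) S

InAv : List (List ℕ) → List ℕ → Set
InAv S π = IsPerm π × Avoids π S

_⊕_ : List ℕ → List ℕ → List ℕ
π ⊕ σ = π ++ map (_+ length π) σ

_⊖_ : List ℕ → List ℕ → List ℕ
π ⊖ σ = map (_+ length σ) π ++ σ

infixl 6 _⊕_ _⊖_

one : List ℕ
one = 1 ∷ []

IsDecreasingPerm : List ℕ → Set
IsDecreasingPerm π = IsPerm π × Linked _>_ π

IsFibonacci : List ℕ → Set
IsFibonacci = InAv ((2 ∷ 3 ∷ 1 ∷ []) ∷ (3 ∷ 1 ∷ 2 ∷ []) ∷ (3 ∷ 2 ∷ 1 ∷ []) ∷ [])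

B₁ : List (List ℕ)
B₁ = (2 ∷ 3 ∷ 1 ∷ []) ∷ (3 ∷ 1 ∷ 2 ∷ []) ∷ (1 ∷ 4 ∷ 3 ∷ 2 ∷ []) ∷ []

-- Let τ begin with t. An entry below t that follows an entry above t would complete a 231 with t,
-- and an ascent among the entries below t would complete a 312 with t; so after t come the entries
-- below t in decreasing order, then those above t. As τ is a permutation, it begins t, t − 1, …, 1,
-- i.e. τ = (π ⊖ 1) ⊕ σ with π decreasing; σ avoids 231 and 312 because τ does, and 321 because t
-- followed by a 321 of σ is a 1432.
-- Conversely, in D ⊕ σ with D decreasing, an occurrence of 231 or 312 can take neither an ascent
-- from D nor an entry of D followed by a smaller entry, so it lies in σ; an occurrence of 1432 takes
-- at most its 1 from D, so its 432 is a 321 in σ.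
module Submission where

open import Defs
open import Data.Bool using (T)
open import Data.Empty using (⊥-elim)
open import Data.Fin using (zero; suc; cast; #_)
open import Data.Fin.Properties using (cast-trans; cast-is-id)
open import Data.List
  using (List; []; _∷_; _++_; map; length; lookup; take; drop; upTo; downFrom; applyUpTo)
open import Data.List.Properties
  using ( length-map; length-++; length-downFrom; map-upTo; map-cong; map-∘; map-id; map-id-local
        ; reverse-upTo)
open import Data.List.Membership.Propositional using (_∈_)
open import Data.List.Membership.Propositional.Properties
  using (∈-map⁺; ∈-map⁻; ∈-upTo⁺; ∈-upTo⁻; ∈-++⁻; ∈-++⁺ˡ)
open import Data.List.Relation.Binary.Permutation.Propositional using (_↭_; ↭-sym; ↭-trans; ↭⇒↭ₛ)
open import Data.List.Relation.Binary.Permutation.Propositional.Properties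
  using (∈-resp-↭; ↭-reverse; ++⁺; ++⁺ʳ; drop-mid) renaming (map⁺ to ↭-map⁺)
import Data.List.Relation.Binary.Permutation.Setoid.Properties as ↭ₛ
open import Data.List.Relation.Binary.Sublist.Propositional
  using (_⊆_; _∷_; _∷ʳ_; []; ⊆-refl; ⊆-trans; from∈)
open import Data.List.Relation.Binary.Sublist.Propositional.Properties
  using (∷ˡ⁻; ++⁺ˡ; All-resp-⊆) renaming (map⁺ to ⊆-map⁺)
open import Data.List.Relation.Unary.All as All using (All; []; _∷_)
import Data.List.Relation.Unary.All.Properties as All
open import Data.List.Relation.Unary.AllPairs using (AllPairs; []; _∷_)
open import Data.List.Relation.Unary.Any using (here; there)
open import Data.List.Relation.Unary.Linked.Properties using (AllPairs⇒Linked; Linked⇒AllPairs)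
open import Data.List.Relation.Unary.Unique.Propositional using (Unique)
import Data.List.Relation.Unary.Unique.Propositional.Properties as Unique
open import Data.Nat using (ℕ; zero; suc; _+_; _∸_; _<_; _≤_; _>_; _<ᵇ_; s≤s; z≤n)
open import Data.Nat.Properties
open import Data.Product using (∃; ∃₂; _×_; _,_; proj₁; proj₂)
open import Data.Sum using (inj₁; inj₂)
open import Function.Base using (_∘_; const; flip)
open import Function.Bundles using (_⇔_; mk⇔; Equivalence)
import Function.Properties.Equivalence as ⇔
open import Relation.Binary.Definitions using (tri<; tri≈; tri>)
open import Relation.Binary.PropositionalEquality
  using (_≡_; _≢_; refl; sym; trans; cong; cong₂; subst; subst₂; module ≡-Reasoning)
open import Relation.Binary.PropositionalEquality.Properties using (setoid)
open import Relation.Nullary using (¬_)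

private
  variable
    xs ys L : List ℕ

-- `cast` ignores its (irrelevant) proof argument, so recursion through it needs no transport.
lookup-map : ∀ (f : ℕ → ℕ) xs i → lookup (map f xs) i ≡ f (lookup xs (cast (length-map f xs) i))
lookup-map f (x ∷ xs) zero    = refl
lookup-map f (x ∷ xs) (suc i) = lookup-map f xs i

orderIso-sym : OrderIso xs ys → OrderIso ys xs
orderIso-sym {xs} {ys} (eq , iso) = sym eq , λ i j →
  subst₂ (λ a b → (lookup ys a < lookup ys b) ⇔ (lookup xs (cast (sym eq) i) < lookup xs (cast (sym eq) j)))
         (cast-cancel i) (cast-cancel j)
         (⇔.sym (iso (cast (sym eq) i) (cast (sym eq) j)))
  where
  cast-cancel : ∀ i → cast eq (cast (sym eq) i) ≡ i
  cast-cancel i = trans (cast-trans (sym eq) eq i) (cast-is-id _ i)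

orderIso-trans : ∀ {zs} → OrderIso xs ys → OrderIso ys zs → OrderIso xs zs
orderIso-trans {xs = xs} {zs = zs} (eq₁ , iso₁) (eq₂ , iso₂) = trans eq₁ eq₂ , λ i j →
  subst₂ (λ a b → (lookup xs i < lookup xs j) ⇔ (lookup zs a < lookup zs b))
         (cast-trans eq₁ eq₂ i) (cast-trans eq₁ eq₂ j)
         (⇔.trans (iso₁ i j) (iso₂ (cast eq₁ i) (cast eq₁ j)))

orderIso-map : ∀ {f : ℕ → ℕ} → (∀ {x y} → (x < y) ⇔ (f x < f y)) →
               OrderIso (map f xs) ys ⇔ OrderIso xs ys
orderIso-map {xs} {ys} {f} f-< = mk⇔
  (orderIso-trans {xs = xs} {ys = map f xs} {zs = ys} (orderIso-sym {xs = map f xs} {ys = xs} f[xs]≅xs))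
  (orderIso-trans {xs = map f xs} {ys = xs} {zs = ys} f[xs]≅xs)
  where
  f[xs]≅xs : OrderIso (map f xs) xs
  f[xs]≅xs = length-map f xs , λ i j →
    subst₂ (λ a b → (a < b) ⇔ (lookup xs (cast (length-map f xs) i) < lookup xs (cast (length-map f xs) j)))
           (sym (lookup-map f xs i)) (sym (lookup-map f xs j)) (⇔.sym f-<)

-- The pattern entries are compared with `_<ᵇ_`, so for a literal pattern these proofs are `_`.
data Concordant : ℕ × ℕ → ℕ × ℕ → Set where
  ascending  : ∀ {x u y v} → x < y → T (u <ᵇ v) → Concordant (x , u) (y , v)
  descending : ∀ {x u y v} → y < x → T (v <ᵇ u) → Concordant (x , u) (y , v)

concordant⇒⇔ : ∀ {x u y v} → Concordant (x , u) (y , v) → (x < y) ⇔ (u < v)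
concordant⇒⇔ (ascending x<y u<v)  = mk⇔ (const (<ᵇ⇒< _ _ u<v)) (const x<y)
concordant⇒⇔ (descending y<x v<u) =
  mk⇔ (λ x<y → ⊥-elim (<-asym x<y y<x)) (λ u<v → ⊥-elim (<-asym u<v (<ᵇ⇒< _ _ v<u)))

concordant-sym : ∀ {p q} → Concordant p q → Concordant q p
concordant-sym (ascending x<y u<v)  = descending x<y u<v
concordant-sym (descending y<x v<u) = ascending y<x v<u

orderIso-concordant : ∀ ps → AllPairs Concordant ps → OrderIso (map proj₁ ps) (map proj₂ ps)
orderIso-concordant ps cs = length-pairs ps , go cs
  where
  length-pairs : ∀ ps → length (map proj₁ ps) ≡ length (map proj₂ ps)
  length-pairs ps = trans (length-map proj₁ ps) (sym (length-map proj₂ ps))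

  lookup-concordant : ∀ {p ps} → All (Concordant p) ps → ∀ j →
    Concordant p (lookup (map proj₁ ps) j , lookup (map proj₂ ps) (cast (length-pairs ps) j))
  lookup-concordant (c ∷ _)  zero    = c
  lookup-concordant (_ ∷ cs) (suc j) = lookup-concordant cs j

  go : ∀ {ps} → AllPairs Concordant ps → ∀ i j →
    (lookup (map proj₁ ps) i < lookup (map proj₁ ps) j) ⇔
    (lookup (map proj₂ ps) (cast (length-pairs ps) i) < lookup (map proj₂ ps) (cast (length-pairs ps) j))
  go (_ ∷ _)  zero    zero    = mk⇔ (⊥-elim ∘ <-irrefl refl) (⊥-elim ∘ <-irrefl refl)
  go (c ∷ _)  zero    (suc j) = concordant⇒⇔ (lookup-concordant c j)
  go (c ∷ _)  (suc i) zero    = concordant⇒⇔ (concordant-sym (lookup-concordant c i))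
  go (_ ∷ cs) (suc i) (suc j) = go cs i j

orderIso-ascent : ((eq , _) : OrderIso xs ys) → ∀ i j →
                  T (lookup ys (cast eq i) <ᵇ lookup ys (cast eq j)) → lookup xs i < lookup xs j
orderIso-ascent (_ , iso) i j u<v = Equivalence.from (iso i j) (<ᵇ⇒< _ _ u<v)

-- Containment of the patterns 231, 312, 321 and 1432

contains-mono : ∀ {p} → xs ⊆ ys → Contains xs p → Contains ys p
contains-mono xs⊆ys (τ , τ⊆xs , iso) = τ , ⊆-trans τ⊆xs xs⊆ys , iso

⊆-map⁻ : ∀ (f : ℕ → ℕ) ys → xs ⊆ map f ys → ∃ λ zs → zs ⊆ ys × xs ≡ map f zs
⊆-map⁻ f []       []           = [] , [] , refl
⊆-map⁻ f (y ∷ ys) (_ ∷ʳ sub)   with zs , zs⊆ys , refl ← ⊆-map⁻ f ys sub = zs , y ∷ʳ zs⊆ys , refl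
⊆-map⁻ f (y ∷ ys) (refl ∷ sub) with zs , zs⊆ys , refl ← ⊆-map⁻ f ys sub = y ∷ zs , refl ∷ zs⊆ys , refl

+-<-⇔ : ∀ t {x y} → (x < y) ⇔ (x + t < y + t)
+-<-⇔ t = mk⇔ (+-monoˡ-< t) (+-cancelʳ-< t _ _)

contains-shift : ∀ t {σ p} → Contains (map (_+ t) σ) p ⇔ Contains σ p
contains-shift t {σ} {p} = mk⇔ to from
  where
  shift-iso : ∀ τ → OrderIso (map (_+ t) τ) p ⇔ OrderIso τ p
  shift-iso τ = orderIso-map {xs = τ} {ys = p} (+-<-⇔ t)

  to : Contains (map (_+ t) σ) p → Contains σ p
  to (_ , sub , iso) with τ , τ⊆σ , refl ← ⊆-map⁻ (_+ t) σ sub =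
    τ , τ⊆σ , Equivalence.to (shift-iso τ) iso

  from : Contains σ p → Contains (map (_+ t) σ) p
  from (τ , τ⊆σ , iso) = map (_+ t) τ , ⊆-map⁺ (_+ t) τ⊆σ , Equivalence.from (shift-iso τ) iso

avoids-shift : ∀ t {σ ps} → Avoids σ ps → Avoids (map (_+ t) σ) ps
avoids-shift t = All.map λ {p} ¬occ → ¬occ ∘ Equivalence.to (contains-shift t {p = p})

triple-occurrence : ∀ {x y z} → Contains L (x ∷ y ∷ z ∷ []) →
  ∃₂ λ a b → ∃ λ c → (a ∷ b ∷ c ∷ []) ⊆ L × OrderIso (a ∷ b ∷ c ∷ []) (x ∷ y ∷ z ∷ [])
triple-occurrence ((a ∷ b ∷ c ∷ []) , sub , iso) = a , b , c , sub , iso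
triple-occurrence ([]                  , _ , () , _)
triple-occurrence ((_ ∷ [])            , _ , () , _)
triple-occurrence ((_ ∷ _ ∷ [])        , _ , () , _)
triple-occurrence ((_ ∷ _ ∷ _ ∷ _ ∷ _) , _ , () , _)

quadruple-occurrence : ∀ {x y z w} → Contains L (x ∷ y ∷ z ∷ w ∷ []) →
  ∃₂ λ a b → ∃₂ λ c d → (a ∷ b ∷ c ∷ d ∷ []) ⊆ L × OrderIso (a ∷ b ∷ c ∷ d ∷ []) (x ∷ y ∷ z ∷ w ∷ [])
quadruple-occurrence ((a ∷ b ∷ c ∷ d ∷ []) , sub , iso) = a , b , c , d , sub , iso
quadruple-occurrence ([]                      , _ , () , _)
quadruple-occurrence ((_ ∷ [])                , _ , () , _)
quadruple-occurrence ((_ ∷ _ ∷ [])            , _ , () , _)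
quadruple-occurrence ((_ ∷ _ ∷ _ ∷ [])        , _ , () , _)
quadruple-occurrence ((_ ∷ _ ∷ _ ∷ _ ∷ _ ∷ _) , _ , () , _)

P231 P312 P321 P1432 : List ℕ
P231  = 2 ∷ 3 ∷ 1 ∷ []
P312  = 3 ∷ 1 ∷ 2 ∷ []
P321  = 3 ∷ 2 ∷ 1 ∷ []
P1432 = 1 ∷ 4 ∷ 3 ∷ 2 ∷ []

Occ231 Occ312 Occ321 Occ1432 : List ℕ → Set
Occ231  L = ∃₂ λ a b → ∃ λ c → (a ∷ b ∷ c ∷ []) ⊆ L × c < a × a < b
Occ312  L = ∃₂ λ a b → ∃ λ c → (a ∷ b ∷ c ∷ []) ⊆ L × b < c × c < a
Occ321  L = ∃₂ λ a b → ∃ λ c → (a ∷ b ∷ c ∷ []) ⊆ L × c < b × b < a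
Occ1432 L = ∃₂ λ a b → ∃₂ λ c d → (a ∷ b ∷ c ∷ d ∷ []) ⊆ L × a < d × d < c × c < b

contains-231⇔ : Contains L P231 ⇔ Occ231 L
contains-231⇔ = mk⇔ to from
  where
  to : Contains _ P231 → Occ231 _
  to occ with a , b , c , sub , iso ← triple-occurrence occ =
    a , b , c , sub , orderIso-ascent iso (# 2) (# 0) _ , orderIso-ascent iso (# 0) (# 1) _

  from : Occ231 _ → Contains _ P231
  from (a , b , c , sub , c<a , a<b) = _ , sub , orderIso-concordant ((a , 2) ∷ (b , 3) ∷ (c , 1) ∷ [])
    ((ascending a<b _ ∷ descending c<a _ ∷ []) ∷ (descending (<-trans c<a a<b) _ ∷ []) ∷ [] ∷ [])

contains-312⇔ : Contains L P312 ⇔ Occ312 L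
contains-312⇔ = mk⇔ to from
  where
  to : Contains _ P312 → Occ312 _
  to occ with a , b , c , sub , iso ← triple-occurrence occ =
    a , b , c , sub , orderIso-ascent iso (# 1) (# 2) _ , orderIso-ascent iso (# 2) (# 0) _

  from : Occ312 _ → Contains _ P312
  from (a , b , c , sub , b<c , c<a) = _ , sub , orderIso-concordant ((a , 3) ∷ (b , 1) ∷ (c , 2) ∷ [])
    ((descending (<-trans b<c c<a) _ ∷ descending c<a _ ∷ []) ∷ (ascending b<c _ ∷ []) ∷ [] ∷ [])

contains-321⇔ : Contains L P321 ⇔ Occ321 L
contains-321⇔ = mk⇔ to from
  where
  to : Contains _ P321 → Occ321 _
  to occ with a , b , c , sub , iso ← triple-occurrence occ =
    a , b , c , sub , orderIso-ascent iso (# 2) (# 1) _ , orderIso-ascent iso (# 1) (# 0) _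

  from : Occ321 _ → Contains _ P321
  from (a , b , c , sub , c<b , b<a) = _ , sub , orderIso-concordant ((a , 3) ∷ (b , 2) ∷ (c , 1) ∷ [])
    ((descending b<a _ ∷ descending (<-trans c<b b<a) _ ∷ []) ∷ (descending c<b _ ∷ []) ∷ [] ∷ [])

contains-1432⇔ : Contains L P1432 ⇔ Occ1432 L
contains-1432⇔ = mk⇔ to from
  where
  to : Contains _ P1432 → Occ1432 _
  to occ with a , b , c , d , sub , iso ← quadruple-occurrence occ =
    a , b , c , d , sub , orderIso-ascent iso (# 0) (# 3) _ , orderIso-ascent iso (# 3) (# 2) _ ,
    orderIso-ascent iso (# 2) (# 1) _

  from : Occ1432 _ → Contains _ P1432
  from (a , b , c , d , sub , a<d , d<c , c<b) =
    _ , sub , orderIso-concordant ((a , 1) ∷ (b , 4) ∷ (c , 3) ∷ (d , 2) ∷ [])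
      ((ascending a<b _ ∷ ascending a<c _ ∷ ascending a<d _ ∷ []) ∷
       (descending c<b _ ∷ descending d<b _ ∷ []) ∷
       (descending d<c _ ∷ []) ∷ [] ∷ [])
    where
    a<c = <-trans a<d d<c
    a<b = <-trans a<c c<b
    d<b = <-trans d<c c<b

[1⋯_] : ℕ → List ℕ
[1⋯ n ] = map suc (upTo n)

∈-[1⋯] : ∀ {x n} → x ∈ [1⋯ n ] ⇔ (1 ≤ x × x ≤ n)
∈-[1⋯] = mk⇔ to from
  where
  to : ∀ {x n} → x ∈ [1⋯ n ] → 1 ≤ x × x ≤ n
  to x∈ with _ , y∈ , refl ← ∈-map⁻ suc x∈ = s≤s z≤n , ∈-upTo⁻ y∈

  from : ∀ {x n} → 1 ≤ x × x ≤ n → x ∈ [1⋯ n ]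
  from {suc x} (_ , x<n) = ∈-map⁺ suc (∈-upTo⁺ x<n)

applyUpTo-+ : ∀ (f : ℕ → ℕ) m n → applyUpTo f (m + n) ≡ applyUpTo f m ++ applyUpTo (f ∘ (m +_)) n
applyUpTo-+ f zero    n = refl
applyUpTo-+ f (suc m) n = cong (f 0 ∷_) (applyUpTo-+ (f ∘ suc) m n)

[1⋯]-+ : ∀ m n → [1⋯ m + n ] ≡ [1⋯ m ] ++ map (_+ m) [1⋯ n ]
[1⋯]-+ m n = begin
  map suc (upTo (m + n))                             ≡⟨ map-upTo suc (m + n) ⟩
  applyUpTo suc (m + n)                              ≡⟨ applyUpTo-+ suc m n ⟩
  applyUpTo suc m ++ applyUpTo (λ x → suc (m + x)) n ≡⟨ cong₂ _++_ (sym (map-upTo suc m)) (sym (map-upTo _ n)) ⟩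
  [1⋯ m ] ++ map (λ x → suc (m + x)) (upTo n)        ≡⟨ cong ([1⋯ m ] ++_) (map-cong suc-+-comm (upTo n)) ⟩
  [1⋯ m ] ++ map ((_+ m) ∘ suc) (upTo n)             ≡⟨ cong ([1⋯ m ] ++_) (map-∘ (upTo n)) ⟩
  [1⋯ m ] ++ map (_+ m) [1⋯ n ]                      ∎
  where
  open ≡-Reasoning
  suc-+-comm : ∀ x → suc (m + x) ≡ suc x + m
  suc-+-comm x = cong suc (+-comm m x)

countdown : ℕ → List ℕ
countdown n = map suc (downFrom n)

length-countdown : ∀ n → length (countdown n) ≡ n
length-countdown n = trans (length-map suc (downFrom n)) (length-downFrom n)

countdown↭ : ∀ n → countdown n ↭ [1⋯ n ]
countdown↭ n = ↭-map⁺ suc (subst (_↭ upTo n) (reverse-upTo n) (↭-reverse (upTo n)))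

∈-countdown : ∀ {x n} → x ∈ countdown n ⇔ (1 ≤ x × x ≤ n)
∈-countdown {n = n} = ⇔.trans (mk⇔ (∈-resp-↭ (countdown↭ n)) (∈-resp-↭ (↭-sym (countdown↭ n)))) ∈-[1⋯]

countdown-decreasing : ∀ n → AllPairs _>_ (countdown n)
countdown-decreasing zero    = []
countdown-decreasing (suc n) =
  All.tabulate (s≤s ∘ proj₂ ∘ Equivalence.to ∈-countdown) ∷ countdown-decreasing n

countdown-⊖-one : ∀ n → countdown n ⊖ one ≡ countdown (suc n)
countdown-⊖-one zero    = refl
countdown-⊖-one (suc n) = cong₂ _∷_ (+-comm (suc n) 1) (countdown-⊖-one n)

∈-isPerm : IsPerm xs → ∀ {x} → x ∈ xs ⇔ (1 ≤ x × x ≤ length xs)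
∈-isPerm xs↭ = ⇔.trans (mk⇔ (∈-resp-↭ xs↭) (∈-resp-↭ (↭-sym xs↭))) ∈-[1⋯]

isPerm-unique : IsPerm xs → Unique xs
isPerm-unique xs↭ =
  ↭ₛ.Unique-resp-↭ (setoid ℕ) (↭⇒↭ₛ (↭-sym xs↭)) (Unique.map⁺ suc-injective (Unique.upTo⁺ _))

isPerm-bounded : IsPerm xs → All (_≤ length xs) xs
isPerm-bounded xs↭ = All.tabulate (proj₂ ∘ Equivalence.to (∈-isPerm xs↭))

shifted-above : ∀ t {σ} → IsPerm σ → All (t <_) (map (_+ t) σ)
shifted-above t σ↭ = All.map⁺ (All.tabulate (m<n+m t ∘ proj₁ ∘ Equivalence.to (∈-isPerm σ↭)))

length-⊕ : ∀ π σ → length (π ⊕ σ) ≡ length π + length σ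
length-⊕ π σ = trans (length-++ π) (cong (length π +_) (length-map _ σ))

[1⋯]-⊕ : ∀ π σ → [1⋯ length (π ⊕ σ) ] ≡ [1⋯ length π ] ++ map (_+ length π) [1⋯ length σ ]
[1⋯]-⊕ π σ = trans (cong [1⋯_] (length-⊕ π σ)) ([1⋯]-+ (length π) (length σ))

⊕-isPerm : ∀ {π σ} → IsPerm π → IsPerm σ → IsPerm (π ⊕ σ)
⊕-isPerm {π} {σ} π↭ σ↭ = subst (π ⊕ σ ↭_) (sym ([1⋯]-⊕ π σ)) (++⁺ π↭ (↭-map⁺ (_+ length π) σ↭))

++-cancelˡ-↭ : ∀ xs {ys zs : List ℕ} → xs ++ ys ↭ xs ++ zs → ys ↭ zs
++-cancelˡ-↭ []       ys↭zs = ys↭zs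
++-cancelˡ-↭ (x ∷ xs) ys↭zs = ++-cancelˡ-↭ xs (drop-mid [] [] ys↭zs)

map-+-∸ : ∀ t xs → map (_∸ t) (map (_+ t) xs) ≡ xs
map-+-∸ t xs = trans (sym (map-∘ xs)) (trans (map-cong (λ x → m+n∸n≡m x t) xs) (map-id xs))

⊕-isPerm⁻ : ∀ {π σ} → IsPerm π → IsPerm (π ⊕ σ) → IsPerm σ
⊕-isPerm⁻ {π} {σ} π↭ π⊕σ↭ =
  subst₂ _↭_ (map-+-∸ t σ) (map-+-∸ t [1⋯ length σ ]) (↭-map⁺ (_∸ t) shifted↭)
  where
  t : ℕ
  t = length π

  shifted↭ : map (_+ t) σ ↭ map (_+ t) [1⋯ length σ ]
  shifted↭ = ++-cancelˡ-↭ [1⋯ t ] (↭-trans (++⁺ʳ _ (↭-sym π↭)) (subst (π ⊕ σ ↭_) ([1⋯]-⊕ π σ) π⊕σ↭))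

∈-∷⁻ : ∀ {x y} → x ≢ y → x ∈ y ∷ ys → x ∈ ys
∈-∷⁻ x≢y (here x≡y)   = ⊥-elim (x≢y x≡y)
∈-∷⁻ x≢y (there x∈ys) = x∈ys

decreasing-≡ : AllPairs _>_ xs → AllPairs _>_ ys → (∀ {z} → z ∈ xs ⇔ z ∈ ys) → xs ≡ ys
decreasing-≡ {[]}     {[]}     _ _ _    = refl
decreasing-≡ {[]}     {y ∷ ys} _ _ same with () ← Equivalence.from same (here refl)
decreasing-≡ {x ∷ xs} {[]}     _ _ same with () ← Equivalence.to same (here refl)
decreasing-≡ {x ∷ xs} {y ∷ ys} (x>xs ∷ xs↘) (y>ys ∷ ys↘) same =
  cong₂ _∷_ x≡y (decreasing-≡ xs↘ ys↘ (mk⇔ (tail x>xs same x≡y) (tail y>ys (⇔.sym same) (sym x≡y))))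
  where
  x≡y : x ≡ y
  x≡y with Equivalence.to same (here refl) | Equivalence.from same (here refl)
  ... | here x≡y   | _          = x≡y
  ... | there _    | here y≡x   = sym y≡x
  ... | there x∈ys | there y∈xs = ⊥-elim (<-asym (All.lookup y>ys x∈ys) (All.lookup x>xs y∈xs))

  tail : ∀ {x y xs ys z} → All (x >_) xs → (∀ {z} → z ∈ x ∷ xs ⇔ z ∈ y ∷ ys) → x ≡ y →
         z ∈ xs → z ∈ ys
  tail x>xs same refl z∈xs = ∈-∷⁻ (<⇒≢ (All.lookup x>xs z∈xs)) (Equivalence.to same (there z∈xs))

countdown-isDecreasingPerm : ∀ n → IsDecreasingPerm (countdown n)
countdown-isDecreasingPerm n =
  subst (λ m → countdown n ↭ [1⋯ m ]) (sym (length-countdown n)) (countdown↭ n) ,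
  AllPairs⇒Linked (countdown-decreasing n)

decreasingPerm≡countdown : ∀ {π} → IsDecreasingPerm π → π ≡ countdown (length π)
decreasingPerm≡countdown (π↭ , π↘) =
  decreasing-≡ (Linked⇒AllPairs (flip <-trans) π↘) (countdown-decreasing _)
               (⇔.trans (∈-isPerm π↭) (⇔.sym ∈-countdown))

AllPairs-resp-⊆ : ∀ {A : Set} {R : A → A → Set} {xs ys : List A} →
                  xs ⊆ ys → AllPairs R ys → AllPairs R xs
AllPairs-resp-⊆ []           []         = []
AllPairs-resp-⊆ (_ ∷ʳ sub)   (_ ∷ rys)  = AllPairs-resp-⊆ sub rys
AllPairs-resp-⊆ (refl ∷ sub) (ry ∷ rys) = All-resp-⊆ sub ry ∷ AllPairs-resp-⊆ sub rys

-- A decreasing block followed by a Fibonacci permutation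

split-⊆-++ : ∀ {A : Set} {zs : List A} xs {ys} → zs ⊆ xs ++ ys → ∃ λ k → take k zs ⊆ xs × drop k zs ⊆ ys
split-⊆-++ []       sub          = 0 , [] , sub
split-⊆-++ (x ∷ xs) (_ ∷ʳ sub)   with k , front , back ← split-⊆-++ xs sub = k , x ∷ʳ front , back
split-⊆-++ (x ∷ xs) (refl ∷ sub) with k , front , back ← split-⊆-++ xs sub = suc k , refl ∷ front , back

module _ {t : ℕ} {D S : List ℕ} (D↘ : AllPairs _>_ D) (D≤t : All (_≤ t) D) (t<S : All (t <_) S) where

  private
    Split : List ℕ → Set
    Split zs = ∃ λ k → AllPairs _>_ (take k zs) × All (_≤ t) (take k zs) × All (t <_) (drop k zs)
                     × drop k zs ⊆ S

    split : ∀ {zs} → zs ⊆ D ++ S → Split zs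
    split sub with k , front , back ← split-⊆-++ D sub =
      k , AllPairs-resp-⊆ front D↘ , All-resp-⊆ front D≤t , All-resp-⊆ back t<S , back

  ++-avoids-231 : ¬ Occ231 S → ¬ Occ231 (D ++ S)
  ++-avoids-231 ¬occ (a , b , c , sub , c<a , a<b) with split sub
  ... | 0           , _             , _        , _            , sub′ = ¬occ (a , b , c , sub′ , c<a , a<b)
  ... | 1           , _             , a≤t ∷ [] , _ ∷ t<c ∷ [] , _    = <-asym c<a (≤-<-trans a≤t t<c)
  ... | suc (suc _) , (b<a ∷ _) ∷ _ , _        , _            , _    = <-asym a<b b<a

  ++-avoids-312 : ¬ Occ312 S → ¬ Occ312 (D ++ S)
  ++-avoids-312 ¬occ (a , b , c , sub , b<c , c<a) with split sub
  ... | 0                 , _                 , _        , _            , sub′ =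
    ¬occ (a , b , c , sub′ , b<c , c<a)
  ... | 1                 , _                 , a≤t ∷ [] , t<b ∷ _ ∷ [] , _    =
    <-asym (<-trans b<c c<a) (≤-<-trans a≤t t<b)
  ... | 2                 , _                 , a≤t ∷ _  , t<c ∷ []     , _    =
    <-asym c<a (≤-<-trans a≤t t<c)
  ... | suc (suc (suc _)) , _ ∷ (c<b ∷ _) ∷ _ , _        , _            , _    =
    <-asym b<c c<b

  ++-avoids-1432 : ¬ Occ321 S → ¬ Occ1432 (D ++ S)
  ++-avoids-1432 ¬occ (a , b , c , d , sub , a<d , d<c , c<b) with split sub
  ... | 0           , _             , _ , _ , sub′ = ¬occ (b , c , d , ∷ˡ⁻ sub′ , d<c , c<b)
  ... | 1           , _             , _ , _ , sub′ = ¬occ (b , c , d , sub′ , d<c , c<b)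
  ... | suc (suc _) , (b<a ∷ _) ∷ _ , _ , _ , _    = <-asym (<-trans a<d (<-trans d<c c<b)) b<a

  ++-avoids : Avoids S (P231 ∷ P312 ∷ P321 ∷ []) → Avoids (D ++ S) B₁
  ++-avoids (¬231 ∷ ¬312 ∷ ¬321 ∷ []) =
    ++-avoids-231 (¬231 ∘ Equivalence.from contains-231⇔) ∘ Equivalence.to contains-231⇔ ∷
    ++-avoids-312 (¬312 ∘ Equivalence.from contains-312⇔) ∘ Equivalence.to contains-312⇔ ∷
    ++-avoids-1432 (¬321 ∘ Equivalence.from contains-321⇔) ∘ Equivalence.to contains-1432⇔ ∷ []

⊕-∈Av : ∀ {π σ} → IsDecreasingPerm π → IsFibonacci σ → InAv B₁ (π ⊕ σ)
⊕-∈Av (π↭ , π↘) (σ↭ , σ-avoids) =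
  ⊕-isPerm π↭ σ↭ ,
  ++-avoids (Linked⇒AllPairs (flip <-trans) π↘) (isPerm-bounded π↭) (shifted-above _ σ↭)
            (avoids-shift _ σ-avoids)

⊕-∈Av⁻ : ∀ {x π σ} → IsPerm (x ∷ π) → InAv B₁ ((x ∷ π) ⊕ σ) → IsFibonacci σ
⊕-∈Av⁻ {x} {π} {σ} xπ↭ (τ↭ , ¬231 ∷ ¬312 ∷ ¬1432 ∷ []) = σ↭ , ¬231 ∘ lift ∷ ¬312 ∘ lift ∷ ¬321 ∷ []
  where
  t : ℕ
  t = length (x ∷ π)

  σ↭ : IsPerm σ
  σ↭ = ⊕-isPerm⁻ xπ↭ τ↭

  lift : ∀ {p} → Contains σ p → Contains ((x ∷ π) ⊕ σ) p
  lift {p} = contains-mono {p = p} (++⁺ˡ (x ∷ π) ⊆-refl) ∘ Equivalence.from (contains-shift t {p = p})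

  ¬321 : ¬ Contains σ P321
  ¬321 occ
    with b , c , d , sub , d<c , c<b ← Equivalence.to contains-321⇔ (Equivalence.from (contains-shift t {p = P321}) occ)
    with _ ∷ _ ∷ t<d ∷ [] ← All-resp-⊆ sub (shifted-above t σ↭) =
    ¬1432 (Equivalence.from contains-1432⇔
      (x , b , c , d , refl ∷ ++⁺ˡ π sub , ≤-<-trans (All.head (isPerm-bounded xπ↭)) t<d , d<c , c<b))

-- The decreasing run at the start of a B₁-avoider

record HeadSplit (t : ℕ) (rest : List ℕ) : Set where
  field
    smaller larger     : List ℕ
    rest≡              : rest ≡ smaller ++ larger
    smaller-decreasing : AllPairs _>_ smaller
    smaller<t          : All (_< t) smaller
    t<larger           : All (t <_) larger

headSplit : ∀ {t rest} → Unique (t ∷ rest) →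
            ¬ Contains (t ∷ rest) P231 → ¬ Contains (t ∷ rest) P312 → HeadSplit t rest
headSplit {t} {[]} _ _ _ = record
  { smaller = [] ; larger = [] ; rest≡ = refl ; smaller-decreasing = [] ; smaller<t = [] ; t<larger = [] }
headSplit {t} {z ∷ rest} ((t≢z ∷ t∉rest) ∷ z∉rest ∷ unique) ¬231 ¬312 with <-cmp z t
... | tri≈ _ z≡t _ = ⊥-elim (t≢z (sym z≡t))
... | tri> _ _ t<z = record
  { smaller = [] ; larger = z ∷ rest ; rest≡ = refl ; smaller-decreasing = [] ; smaller<t = []
  ; t<larger = t<z ∷ All.tabulate above }
  where
  above : ∀ {y} → y ∈ rest → t < y
  above {y} y∈rest with <-cmp t y
  ... | tri< t<y _ _ = t<y
  ... | tri≈ _ t≡y _ = ⊥-elim (All.lookup t∉rest y∈rest t≡y)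
  ... | tri> _ _ y<t = ⊥-elim (¬231 (Equivalence.from contains-231⇔
      (t , z , y , refl ∷ refl ∷ from∈ y∈rest , y<t , t<z)))
... | tri< z<t _ _ = record
  { smaller = z ∷ smaller ; larger = larger ; rest≡ = cong (z ∷_) rest≡
  ; smaller-decreasing = All.tabulate below ∷ smaller-decreasing
  ; smaller<t = z<t ∷ smaller<t ; t<larger = t<larger }
  where
  skip-z : (t ∷ rest) ⊆ (t ∷ z ∷ rest)
  skip-z = refl ∷ z ∷ʳ ⊆-refl

  open HeadSplit (headSplit (t∉rest ∷ unique) (¬231 ∘ contains-mono skip-z) (¬312 ∘ contains-mono skip-z))

  below : ∀ {y} → y ∈ smaller → y < z
  below {y} y∈smaller with y∈rest ← subst (y ∈_) (sym rest≡) (∈-++⁺ˡ y∈smaller) | <-cmp y z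
  ... | tri< y<z _ _ = y<z
  ... | tri≈ _ y≡z _ = ⊥-elim (All.lookup z∉rest y∈rest (sym y≡z))
  ... | tri> _ _ z<y = ⊥-elim (¬312 (Equivalence.from contains-312⇔
      (t , z , y , refl ∷ refl ∷ from∈ y∈rest , z<y , All.lookup smaller<t y∈smaller)))

headSplit-countdown : ∀ {t rest} → IsPerm (t ∷ rest) → (h : HeadSplit t rest) →
                      t ∷ HeadSplit.smaller h ≡ countdown t
headSplit-countdown {t} {rest} τ↭ h =
  decreasing-≡ (smaller<t ∷ smaller-decreasing) (countdown-decreasing t)
               (⇔.trans (mk⇔ to from) (⇔.sym ∈-countdown))
  where
  open HeadSplit h

  ∈τ : ∀ {x} → x ∈ t ∷ rest ⇔ (1 ≤ x × x ≤ length (t ∷ rest))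
  ∈τ = ∈-isPerm τ↭

  to : ∀ {x} → x ∈ t ∷ smaller → 1 ≤ x × x ≤ t
  to (here refl)     = proj₁ (Equivalence.to ∈τ (here refl)) , ≤-refl
  to (there x∈small) = proj₁ (Equivalence.to ∈τ (there (subst (_ ∈_) (sym rest≡) (∈-++⁺ˡ x∈small)))) ,
                       <⇒≤ (All.lookup smaller<t x∈small)

  from : ∀ {x} → 1 ≤ x × x ≤ t → x ∈ t ∷ smaller
  from (1≤x , x≤t) with Equivalence.from ∈τ (1≤x , ≤-trans x≤t (proj₂ (Equivalence.to ∈τ (here refl))))
  ... | here x≡t     = here x≡t
  ... | there x∈rest with ∈-++⁻ smaller (subst (_ ∈_) rest≡ x∈rest)
  ...   | inj₁ x∈small = there x∈small
  ...   | inj₂ x∈large = ⊥-elim (<-irrefl refl (<-≤-trans (All.lookup t<larger x∈large) x≤t))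

∈Av-countdown-⊕ : ∀ {τ} → τ ≢ [] → InAv B₁ τ → ∃₂ λ k σ → τ ≡ countdown (suc k) ⊕ σ
∈Av-countdown-⊕ {[]}           τ≢[] _        = ⊥-elim (τ≢[] refl)
∈Av-countdown-⊕ {zero ∷ _}     _    (τ↭ , _) with () ← proj₁ (Equivalence.to (∈-isPerm τ↭) (here refl))
∈Av-countdown-⊕ {suc k ∷ rest} _    (τ↭ , ¬231 ∷ ¬312 ∷ _) = k , σ , (begin
  t ∷ rest                     ≡⟨ cong (t ∷_) rest≡ ⟩
  (t ∷ smaller) ++ larger      ≡⟨ cong₂ _++_ (headSplit-countdown τ↭ h) (sym larger≡) ⟩
  countdown t ++ map (_+ t) σ  ≡⟨ cong (λ n → countdown t ++ map (_+ n) σ) (sym (length-countdown t)) ⟩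
  countdown t ⊕ σ              ∎)
  where
  open ≡-Reasoning

  t : ℕ
  t = suc k

  h : HeadSplit t rest
  h = headSplit (isPerm-unique τ↭) ¬231 ¬312

  open HeadSplit h

  σ : List ℕ
  σ = map (_∸ t) larger

  larger≡ : map (_+ t) σ ≡ larger
  larger≡ = trans (sym (map-∘ larger)) (map-id-local (All.map (m∸n+n≡m ∘ <⇒≤) t<larger))

theorem2p5 : (τ : List ℕ) → ¬ (τ ≡ []) →
    InAv B₁ τ ⇔ (∃₂ λ π σ → IsDecreasingPerm π × IsFibonacci σ × (τ ≡ (π ⊖ one) ⊕ σ))
theorem2p5 τ τ≢[] = mk⇔ forth back
  where
  forth : InAv B₁ τ → ∃₂ λ π σ → IsDecreasingPerm π × IsFibonacci σ × (τ ≡ (π ⊖ one) ⊕ σ)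
  forth τ∈Av with k , σ , refl ← ∈Av-countdown-⊕ τ≢[] τ∈Av =
    countdown k , σ , countdown-isDecreasingPerm k ,
    ⊕-∈Av⁻ (proj₁ (countdown-isDecreasingPerm (suc k))) τ∈Av ,
    cong (_⊕ σ) (sym (countdown-⊖-one k))

  back : (∃₂ λ π σ → IsDecreasingPerm π × IsFibonacci σ × (τ ≡ (π ⊖ one) ⊕ σ)) → InAv B₁ τ
  back (π , σ , π↘ , σ-fib , refl) rewrite decreasingPerm≡countdown π↘ | countdown-⊖-one (length π) =
    ⊕-∈Av (countdown-isDecreasingPerm (suc (length π))) σ-fib
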